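{- For all non-negative integers $n,k,\ell$, $L_3(n,k,\ell)$ equals the number of partitions of $n$ into $k+2\ell$ distinct parts whose Durfee square has side $k+\ell$.
   Context: For a partition $\lambda_1\ge\lambda_2\ge\cdots$, the side of its Durfee square is the largest integer $i$ with $\lambda_i\ge i$ ($0$ for the empty partition). A two-color partition is a partition each of whose parts is colored red or green; a part of value $a$ colored green is written $a_g$. $\mathcal{L}_3(n)$ is the set of two-color partitions $\lambda_1>\lambda_2>\cdots>\lambda_m$ of $n$ into numerically distinct parts such that each red part $\lambda_i$ with $i<m$ satisfies $\lambda_i-\lambda_{i+1}\ge 3$, each green part $\lambda_i$ with $i<m$ satisfies $\lambda_i-\lambda_{i+1}\ge 4$, and neither $1_g$ nor $2_g$ occurs as a part. $L_3(n,k,\ell)$ is the number of partitions in $\mathcal{L}_3(n)$ with exactly $k$ red and $\ell$ green parts. -}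

module Defs where

open import Data.Nat using (ℕ; zero; suc; _+_; _≤_; _<_; _≤ᵇ_)
open import Data.Bool using (if_then_else_)
open import Data.List using (List; []; _∷_; length; map)
open import Data.Nat.ListAction using (sum)
open import Data.List.Relation.Unary.All using (All)
open import Data.Product using (_×_; _,_; proj₁; Σ)
open import Data.Unit using (⊤)
open import Relation.Binary.PropositionalEquality using (_≡_)

-- Ordinary partitions into distinct parts, written λ₁ > λ₂ > ⋯ > λₘ > 0
-- as the list [λ₁, …, λₘ].

StrictDec : List ℕ → Set
StrictDec []           = ⊤
StrictDec (_ ∷ [])     = ⊤
StrictDec (a ∷ b ∷ r)  = (b < a) × StrictDec (b ∷ r)

DistinctPartition : ℕ → List ℕ → Set
DistinctPartition n xs = All (λ a → 1 ≤ a) xs × StrictDec xs × sum xs ≡ n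

-- λ_i of the partition (1-indexed); 0 beyond the last part (and for i = 0)
part : List ℕ → ℕ → ℕ
part []      _             = 0
part (x ∷ r) zero          = 0
part (x ∷ r) (suc zero)    = x
part (x ∷ r) (suc (suc i)) = part r (suc i)

-- Side of the Durfee square: the largest i with λ_i ≥ i (0 if none,
-- in particular for the empty partition).  Only i ≤ m (number of parts)
-- can satisfy λ_i ≥ i, so we search i = m, m-1, …, 1 downwards.
largestDurfeeIndex : List ℕ → ℕ → ℕ
largestDurfeeIndex xs zero    = 0
largestDurfeeIndex xs (suc i) =
  if suc i ≤ᵇ part xs (suc i) then suc i else largestDurfeeIndex xs i

durfee : List ℕ → ℕ
durfee xs = largestDurfeeIndex xs (length xs)

data Color : Set where
  red green : Color

gap : Color → ℕ
gap red   = 3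
gap green = 4

PartOK : ℕ × Color → Set
PartOK (a , red)   = 1 ≤ a
PartOK (a , green) = 3 ≤ a

GapOK : List (ℕ × Color) → Set
GapOK []                          = ⊤
GapOK (_ ∷ [])                    = ⊤
GapOK ((a , c) ∷ (b , d) ∷ r)     = (b + gap c ≤ a) × GapOK ((b , d) ∷ r)

countColor : Color → List (ℕ × Color) → ℕ
countColor c []             = 0
countColor red  ((_ , red)   ∷ r) = suc (countColor red r)
countColor red  ((_ , green) ∷ r) = countColor red r
countColor green ((_ , green) ∷ r) = suc (countColor green r)
countColor green ((_ , red)   ∷ r) = countColor green r

-- membership in 𝓛₃(n) (parts listed λ₁ > λ₂ > ⋯ > λₘ; numerical
-- distinctness and decrease follow from the gap conditions)
InL3 : ℕ → List (ℕ × Color) → Set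
InL3 n xs = All PartOK xs × GapOK xs × sum (map proj₁ xs) ≡ n

L3Set : ℕ → ℕ → ℕ → Set
L3Set n k ℓ = Σ (List (ℕ × Color)) λ xs →
  InL3 n xs × countColor red xs ≡ k × countColor green xs ≡ ℓ

DurfeeSet : ℕ → ℕ → ℕ → Set
DurfeeSet n k ℓ = Σ (List ℕ) λ xs →
  DistinctPartition n xs × length xs ≡ k + (ℓ + ℓ) × durfee xs ≡ k + ℓ

-- A partition into distinct parts is peeled apart along its principal hooks:
-- the largest part together with the first column of the remaining parts is
-- a hook of length (largest part) + (number of remaining parts), and removing
-- it leaves again a partition into distinct parts whose Durfee side is one
-- smaller.  Colour the hook green when that column removes a part equal to 1.
-- Distinctness of the parts makes consecutive hook lengths differ by at least
-- 3, or 4 after a green hook, and conversely such gaps are exactly what is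
-- needed to reassemble the hooks into distinct parts.  A partition with Durfee
-- side k + ℓ thus has k + ℓ hooks, and it has k + 2ℓ parts iff ℓ hooks are green.
module Submission where

open import Defs
open import Data.Nat using (ℕ; zero; suc; _+_; _∸_; _≤_; z≤n; s≤s; pred; _≤ᵇ_)
open import Data.Nat.Properties
open import Data.Bool using (if_then_else_)
open import Data.Bool.Properties using (if-float)
open import Data.List using (List; []; _∷_; length; map)
open import Data.Nat.ListAction using (sum)
open import Data.List.Relation.Unary.All as All using (All; []; _∷_)
open import Data.Product using (_×_; _,_; proj₁; proj₂; Σ)
open import Data.Unit using (tt)
open import Relation.Binary.PropositionalEquality
open import Relation.Nullary.Irrelevant using (Irrelevant)
open import Function.Base using (_∘_)
open import Function.Bundles using (_↔_; mk↔ₛ′)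
open import Data.Nat.Tactic.RingSolver using (solve-∀)

Distinct : List ℕ → Set
Distinct xs = All (1 ≤_) xs × StrictDec xs

greenBit : Color → ℕ
greenBit red   = 0
greenBit green = 1

gap≡3+greenBit : ∀ c → gap c ≡ 3 + greenBit c
gap≡3+greenBit red   = refl
gap≡3+greenBit green = refl

reds greens : List (ℕ × Color) → ℕ
reds   = countColor red
greens = countColor green

length≡reds+greens : ∀ xs → length xs ≡ reds xs + greens xs
length≡reds+greens []                = refl
length≡reds+greens ((_ , red)   ∷ r) = cong suc (length≡reds+greens r)
length≡reds+greens ((_ , green) ∷ r) =
  trans (cong suc (length≡reds+greens r)) (sym (+-suc (reds r) (greens r)))

strictDec-∷⁻ : ∀ {y} T → StrictDec (y ∷ T) → StrictDec T
strictDec-∷⁻ []      _       = tt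
strictDec-∷⁻ (_ ∷ _) (_ , s) = s

distinct-∷⁻ : ∀ {y} T → Distinct (y ∷ T) → Distinct T
distinct-∷⁻ T (_ ∷ p , s) = p , strictDec-∷⁻ T s

addColumn : List ℕ → Color → List ℕ
addColumn []      red   = []
addColumn []      green = 1 ∷ []
addColumn (x ∷ μ) c     = suc x ∷ addColumn μ c

removeColumn : List ℕ → List ℕ
removeColumn []                = []
removeColumn (zero ∷ r)        = removeColumn r
removeColumn (suc zero ∷ r)    = removeColumn r
removeColumn (suc (suc x) ∷ r) = suc x ∷ removeColumn r

columnColor : List ℕ → Color
columnColor []                = red
columnColor (zero ∷ r)        = columnColor r
columnColor (suc zero ∷ r)    = green
columnColor (suc (suc x) ∷ r) = columnColor r

length-addColumn : ∀ μ c → length (addColumn μ c) ≡ length μ + greenBit c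
length-addColumn []      red   = refl
length-addColumn []      green = refl
length-addColumn (x ∷ μ) c     = cong suc (length-addColumn μ c)

sum-addColumn : ∀ μ c → sum (addColumn μ c) ≡ length (addColumn μ c) + sum μ
sum-addColumn []      red   = refl
sum-addColumn []      green = refl
sum-addColumn (x ∷ μ) c     = begin
  suc x + sum (addColumn μ c)                ≡⟨ cong (suc x +_) (sum-addColumn μ c) ⟩
  suc x + (length (addColumn μ c) + sum μ)   ≡⟨ cong suc (x+[l+s]≡l+[x+s] x (length (addColumn μ c)) _) ⟩
  suc (length (addColumn μ c)) + (x + sum μ) ∎
  where
  open ≡-Reasoning
  x+[l+s]≡l+[x+s] : ∀ x l s → x + (l + s) ≡ l + (x + s)
  x+[l+s]≡l+[x+s] = solve-∀

pred-part-addColumn : ∀ μ c i → pred (part (addColumn μ c) (suc i)) ≡ part μ (suc i)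
pred-part-addColumn []      red   i       = refl
pred-part-addColumn []      green zero    = refl
pred-part-addColumn []      green (suc i) = refl
pred-part-addColumn (x ∷ μ) c     zero    = refl
pred-part-addColumn (x ∷ μ) c     (suc i) = pred-part-addColumn μ c i

addColumn-positive : ∀ μ c → All (1 ≤_) (addColumn μ c)
addColumn-positive []      red   = []
addColumn-positive []      green = s≤s z≤n ∷ []
addColumn-positive (x ∷ μ) c     = s≤s z≤n ∷ addColumn-positive μ c

strictDec-addColumn⁺ : ∀ μ c → Distinct μ → StrictDec (addColumn μ c)
strictDec-addColumn⁺ []          red   _            = tt
strictDec-addColumn⁺ []          green _            = tt
strictDec-addColumn⁺ (x ∷ [])    red   _            = tt
strictDec-addColumn⁺ (x ∷ [])    green (px ∷ _ , _) = s≤s px , tt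
strictDec-addColumn⁺ (x ∷ y ∷ μ) c     (_ ∷ p , h , s) =
  s≤s h , strictDec-addColumn⁺ (y ∷ μ) c (p , s)

strictDec-addColumn⁻ : ∀ μ c → StrictDec (addColumn μ c) → StrictDec μ
strictDec-addColumn⁻ []          _ _           = tt
strictDec-addColumn⁻ (x ∷ [])    _ _           = tt
strictDec-addColumn⁻ (x ∷ y ∷ μ) c (s≤s h , s) = h , strictDec-addColumn⁻ (y ∷ μ) c s

removeColumn-addColumn : ∀ μ c → All (1 ≤_) μ → removeColumn (addColumn μ c) ≡ μ
removeColumn-addColumn []          red   _       = refl
removeColumn-addColumn []          green _       = refl
removeColumn-addColumn (suc x ∷ μ) c     (_ ∷ p) = cong (suc x ∷_) (removeColumn-addColumn μ c p)

columnColor-addColumn : ∀ μ c → All (1 ≤_) μ → columnColor (addColumn μ c) ≡ c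
columnColor-addColumn []          red   _       = refl
columnColor-addColumn []          green _       = refl
columnColor-addColumn (suc x ∷ μ) c     (_ ∷ p) = columnColor-addColumn μ c p

one-is-last : ∀ T → Distinct (1 ∷ T) → T ≡ []
one-is-last []          _                  = refl
one-is-last (zero ∷ _)  (_ ∷ () ∷ _ , _)
one-is-last (suc _ ∷ _) (_ , s≤s () , _)

addColumn-removeColumn : ∀ T → Distinct T → addColumn (removeColumn T) (columnColor T) ≡ T
addColumn-removeColumn []                _            = refl
addColumn-removeColumn (zero ∷ _)        (() ∷ _ , _)
addColumn-removeColumn (suc zero ∷ T)    distinct rewrite one-is-last T distinct = refl
addColumn-removeColumn (suc (suc x) ∷ T) distinct =
  cong (suc (suc x) ∷_) (addColumn-removeColumn T (distinct-∷⁻ T distinct))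

removeColumn-positive : ∀ T → All (1 ≤_) (removeColumn T)
removeColumn-positive []                = []
removeColumn-positive (zero ∷ T)        = removeColumn-positive T
removeColumn-positive (suc zero ∷ T)    = removeColumn-positive T
removeColumn-positive (suc (suc x) ∷ T) = s≤s z≤n ∷ removeColumn-positive T

distinct-removeColumn : ∀ T → Distinct T → Distinct (removeColumn T)
distinct-removeColumn T distinct@(_ , s) =
  removeColumn-positive T ,
  strictDec-addColumn⁻ (removeColumn T) (columnColor T)
    (subst StrictDec (sym (addColumn-removeColumn T distinct)) s)

part-beyond-length : ∀ xs i → length xs ≤ i → part xs (suc i) ≡ 0
part-beyond-length []           i       _       = refl
part-beyond-length (x ∷ [])     (suc i) _       = refl
part-beyond-length (x ∷ y ∷ xs) (suc i) (s≤s h) = part-beyond-length (y ∷ xs) i h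

largestDurfeeIndex-beyond-length : ∀ xs j → largestDurfeeIndex xs (length xs + j) ≡ durfee xs
largestDurfeeIndex-beyond-length xs zero = cong (largestDurfeeIndex xs) (+-identityʳ (length xs))
largestDurfeeIndex-beyond-length xs (suc j)
  rewrite +-suc (length xs) j | part-beyond-length xs (length xs + j) (m≤m+n (length xs) j)
  = largestDurfeeIndex-beyond-length xs j

-- Lowering both the threshold and the part by one does not change the test;
-- for the part 0, where pred 0 = 0, both tests fail.
durfeeTest-pred : ∀ i p b →
  (if suc (suc i) ≤ᵇ p then suc (suc i) else suc b) ≡ suc (if suc i ≤ᵇ pred p then suc i else b)
durfeeTest-pred i zero    b = refl
durfeeTest-pred i (suc p) b = sym (if-float suc (suc i ≤ᵇ p))

largestDurfeeIndex-hook : ∀ y μ c → 1 ≤ y → ∀ i →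
  largestDurfeeIndex (y ∷ addColumn μ c) (suc i) ≡ suc (largestDurfeeIndex μ i)
largestDurfeeIndex-hook (suc y) μ c _ zero    = refl
largestDurfeeIndex-hook y       μ c h (suc i)
  rewrite largestDurfeeIndex-hook y μ c h i | sym (pred-part-addColumn μ c i)
  = durfeeTest-pred i (part (addColumn μ c) (suc i)) (largestDurfeeIndex μ i)

durfee-hook : ∀ y μ c → 1 ≤ y → durfee (y ∷ addColumn μ c) ≡ suc (durfee μ)
durfee-hook y μ c h = begin
  largestDurfeeIndex (y ∷ addColumn μ c) (suc (length (addColumn μ c)))
    ≡⟨ largestDurfeeIndex-hook y μ c h (length (addColumn μ c)) ⟩
  suc (largestDurfeeIndex μ (length (addColumn μ c)))
    ≡⟨ cong (suc ∘ largestDurfeeIndex μ) (length-addColumn μ c) ⟩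
  suc (largestDurfeeIndex μ (length μ + greenBit c))
    ≡⟨ cong suc (largestDurfeeIndex-beyond-length μ (greenBit c)) ⟩
  suc (durfee μ) ∎
  where open ≡-Reasoning

durfee-∷ : ∀ y T → Distinct (y ∷ T) → durfee (y ∷ T) ≡ suc (durfee (removeColumn T))
durfee-∷ y T distinct@(py ∷ _ , _) =
  subst (λ T′ → durfee (y ∷ T′) ≡ suc (durfee (removeColumn T)))
    (addColumn-removeColumn T (distinct-∷⁻ T distinct))
    (durfee-hook y (removeColumn T) (columnColor T) py)

Admissible : List (ℕ × Color) → Set
Admissible xs = All PartOK xs × GapOK xs

admissible-∷⁻ : ∀ {x} xs → Admissible (x ∷ xs) → Admissible xs
admissible-∷⁻ []      (_ ∷ ps , _)      = ps , tt
admissible-∷⁻ (_ ∷ _) (_ ∷ ps , _ , gs) = ps , gs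

fromHooks : List (ℕ × Color) → List ℕ
fromHooks []            = []
fromHooks ((a , c) ∷ r) = (a ∸ length (addColumn (fromHooks r) c)) ∷ addColumn (fromHooks r) c

1≤m∸n⇒n≤m : ∀ {m n} → 1 ≤ m ∸ n → n ≤ m
1≤m∸n⇒n≤m h = <⇒≤ (m∸n≢0⇒n<m (n>0⇒n≢0 h))

hookGap⇒rowGap : ∀ {L b g a} → L ≤ b → b + (3 + g) ≤ a → 2 + (b ∸ L) ≤ a ∸ suc (L + g)
hookGap⇒rowGap {L} {b} {g} {a} L≤b b+3+g≤a
  with e , refl ← m≤n⇒∃[o]m+o≡n L≤b
  with f , refl ← m≤n⇒∃[o]m+o≡n b+3+g≤a = begin
  2 + (L + e ∸ L)                            ≡⟨ cong (2 +_) (m+n∸m≡n L e) ⟩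
  2 + e                                      ≤⟨ m≤m+n (2 + e) f ⟩
  2 + e + f                                  ≡⟨ sym (m+n∸m≡n (suc (L + g)) (2 + e + f)) ⟩
  suc (L + g) + (2 + e + f) ∸ suc (L + g)    ≡⟨ cong (_∸ suc (L + g)) (regroup L e g f) ⟩
  L + e + (3 + g) + f ∸ suc (L + g)          ∎
  where
  open ≤-Reasoning
  regroup : ∀ L e g f → suc (L + g) + (2 + e + f) ≡ L + e + (3 + g) + f
  regroup = solve-∀

fromHooks-distinct : ∀ xs → Admissible xs → Distinct (fromHooks xs)
fromHooks-distinct []                       _                  = [] , tt
fromHooks-distinct ((a , red) ∷ [])         (pa ∷ _ , _)       = pa ∷ [] , tt
fromHooks-distinct ((a , green) ∷ [])       (s≤s 2≤a ∷ _ , _)  =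
  ≤-trans (s≤s z≤n) 2≤a ∷ s≤s z≤n ∷ [] , 2≤a , tt
fromHooks-distinct ((a , c) ∷ (b , c′) ∷ r) adm@(_ , b+gap≤a , _)
  with fromHooks-distinct ((b , c′) ∷ r) (admissible-∷⁻ ((b , c′) ∷ r) adm)
... | distinct@(pb ∷ _ , _) =
  ≤-trans (s≤s z≤n) rowGap ∷ addColumn-positive (fromHooks ((b , c′) ∷ r)) c ,
  rowGap , strictDec-addColumn⁺ (fromHooks ((b , c′) ∷ r)) c distinct
  where
  μ = addColumn (fromHooks r) c′
  rowGap : 2 + (b ∸ length μ) ≤ a ∸ suc (length (addColumn μ c))
  rowGap = subst (λ t → 2 + (b ∸ length μ) ≤ a ∸ suc t) (sym (length-addColumn μ c))
    (hookGap⇒rowGap (1≤m∸n⇒n≤m pb)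
      (subst (λ t → b + t ≤ a) (gap≡3+greenBit c) b+gap≤a))

column≤hook : ∀ a c r → Admissible ((a , c) ∷ r) → length (addColumn (fromHooks r) c) ≤ a
column≤hook a c r adm with fromHooks-distinct ((a , c) ∷ r) adm
... | (p ∷ _ , _) = 1≤m∸n⇒n≤m p

length-fromHooks : ∀ xs → length (fromHooks xs) ≡ length xs + greens xs
length-fromHooks []                = refl
length-fromHooks ((a , red) ∷ r)   =
  cong suc (trans (length-addColumn (fromHooks r) red)
                  (trans (+-identityʳ _) (length-fromHooks r)))
length-fromHooks ((a , green) ∷ r) =
  cong suc (trans (length-addColumn (fromHooks r) green)
                  (trans (+-comm _ 1) (trans (cong suc (length-fromHooks r))
                                             (sym (+-suc (length r) (greens r))))))

sum-fromHooks : ∀ xs → Admissible xs → sum (fromHooks xs) ≡ sum (map proj₁ xs)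
sum-fromHooks []            _   = refl
sum-fromHooks ((a , c) ∷ r) adm = begin
  a ∸ L + sum (addColumn (fromHooks r) c)   ≡⟨ cong (a ∸ L +_) (sum-addColumn (fromHooks r) c) ⟩
  a ∸ L + (L + sum (fromHooks r))           ≡⟨ sym (+-assoc (a ∸ L) L _) ⟩
  a ∸ L + L + sum (fromHooks r)             ≡⟨ cong₂ _+_ (m∸n+n≡m (column≤hook a c r adm))
                                                         (sum-fromHooks r (admissible-∷⁻ r adm)) ⟩
  a + sum (map proj₁ r)                     ∎
  where
  open ≡-Reasoning
  L = length (addColumn (fromHooks r) c)

durfee-fromHooks : ∀ xs → Admissible xs → durfee (fromHooks xs) ≡ length xs
durfee-fromHooks []            _   = refl
durfee-fromHooks ((a , c) ∷ r) adm with fromHooks-distinct ((a , c) ∷ r) adm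
... | (p ∷ _ , _) =
  trans (durfee-hook _ (fromHooks r) c p) (cong suc (durfee-fromHooks r (admissible-∷⁻ r adm)))

hooks : ℕ → List ℕ → List (ℕ × Color)
hooks zero    _       = []
hooks (suc d) []      = []
hooks (suc d) (y ∷ T) = (y + length T , columnColor T) ∷ hooks d (removeColumn T)

hooks-fromHooks : ∀ xs → Admissible xs → hooks (length xs) (fromHooks xs) ≡ xs
hooks-fromHooks []            _   = refl
hooks-fromHooks ((a , c) ∷ r) adm
  with adm′ ← admissible-∷⁻ r adm
  with positive , _ ← fromHooks-distinct r adm′
  rewrite columnColor-addColumn (fromHooks r) c positive
        | removeColumn-addColumn (fromHooks r) c positive
        | hooks-fromHooks r adm′
        | m∸n+n≡m (column≤hook a c r adm)
  = refl

fromHooks-hooks : ∀ d ys → Distinct ys → durfee ys ≡ d → fromHooks (hooks d ys) ≡ ys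
fromHooks-hooks zero    []      _ _ = refl
fromHooks-hooks zero    (y ∷ T) distinct e with () ← trans (sym (durfee-∷ y T distinct)) e
fromHooks-hooks (suc d) (y ∷ T) distinct e
  with distinctT ← distinct-∷⁻ T distinct
  rewrite fromHooks-hooks d (removeColumn T) (distinct-removeColumn T distinctT)
            (suc-injective (trans (sym (durfee-∷ y T distinct)) e))
        | addColumn-removeColumn T distinctT
  = cong (_∷ T) (m+n∸n≡m y (length T))

partOK-hook : ∀ y μ c → 1 ≤ y → StrictDec (y ∷ addColumn μ c) → PartOK (y + length (addColumn μ c) , c)
partOK-hook y μ       red   py _       = ≤-trans py (m≤m+n y _)
partOK-hook y []      green _  (h , _) = +-monoˡ-≤ 1 h
partOK-hook y (x ∷ μ) green _  (h , _) = +-mono-≤ (≤-trans (s≤s (s≤s z≤n)) h) (s≤s z≤n)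

rowGap⇒hookGap : ∀ {y′ y l g} → 2 + y′ ≤ y → y′ + l + (3 + g) ≤ y + suc (l + g)
rowGap⇒hookGap {y′} {y} {l} {g} h =
  subst (_≤ y + suc (l + g)) (sym (regroup y′ l g)) (+-monoˡ-≤ (suc (l + g)) h)
  where
  regroup : ∀ y′ l g → y′ + l + (3 + g) ≡ 2 + y′ + suc (l + g)
  regroup = solve-∀

gapOK-hook : ∀ d y μ c → StrictDec (y ∷ addColumn μ c) → GapOK (hooks d μ) →
  GapOK ((y + length (addColumn μ c) , c) ∷ hooks d μ)
gapOK-hook zero    y _        c _       _  = tt
gapOK-hook (suc d) y []       c _       _  = tt
gapOK-hook (suc d) y (y′ ∷ μ) c (h , _) gs =
  subst₂ (λ t u → y′ + length μ + t ≤ y + suc u)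
    (sym (gap≡3+greenBit c)) (sym (length-addColumn μ c)) (rowGap⇒hookGap h) , gs

hooks-admissible : ∀ d ys → Distinct ys → Admissible (hooks d ys)
hooks-admissible zero    _       _ = [] , tt
hooks-admissible (suc d) []      _ = [] , tt
hooks-admissible (suc d) (y ∷ T) distinct@(py ∷ _ , s) =
  subst (λ T′ → Admissible ((y + length T′ , c) ∷ hooks d μ)) (addColumn-removeColumn T distinctT)
    (partOK-hook y μ c py s′ ∷ proj₁ ih , gapOK-hook d y μ c s′ (proj₂ ih))
  where
  distinctT = distinct-∷⁻ T distinct
  μ = removeColumn T
  c = columnColor T
  s′ : StrictDec (y ∷ addColumn μ c)
  s′ = subst (λ T′ → StrictDec (y ∷ T′)) (sym (addColumn-removeColumn T distinctT)) s
  ih = hooks-admissible d μ (distinct-removeColumn T distinctT)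

×-irrelevant : ∀ {A B : Set} → Irrelevant A → Irrelevant B → Irrelevant (A × B)
×-irrelevant irrA irrB (a , b) (a′ , b′) = cong₂ _,_ (irrA a a′) (irrB b b′)

partOK-irrelevant : ∀ x → Irrelevant (PartOK x)
partOK-irrelevant (a , red)   = ≤-irrelevant
partOK-irrelevant (a , green) = ≤-irrelevant

gapOK-irrelevant : ∀ xs → Irrelevant (GapOK xs)
gapOK-irrelevant []                      _ _ = refl
gapOK-irrelevant (_ ∷ [])                _ _ = refl
gapOK-irrelevant ((a , c) ∷ (b , d) ∷ r) =
  ×-irrelevant ≤-irrelevant (gapOK-irrelevant ((b , d) ∷ r))

strictDec-irrelevant : ∀ xs → Irrelevant (StrictDec xs)
strictDec-irrelevant []          _ _ = refl
strictDec-irrelevant (_ ∷ [])    _ _ = refl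
strictDec-irrelevant (a ∷ b ∷ r) = ×-irrelevant ≤-irrelevant (strictDec-irrelevant (b ∷ r))

Σ-≡-irrelevant : ∀ {A : Set} {P : A → Set} → (∀ x → Irrelevant (P x)) →
  ∀ {x y} {p : P x} {q : P y} → x ≡ y → _≡_ {A = Σ A P} (x , p) (y , q)
Σ-≡-irrelevant irr {x} {p = p} {q} refl = cong (x ,_) (irr x p q)

module Bijection (n k ℓ : ℕ) where

  L3Set-≡ : {p q : L3Set n k ℓ} → proj₁ p ≡ proj₁ q → p ≡ q
  L3Set-≡ = Σ-≡-irrelevant λ xs →
    ×-irrelevant (×-irrelevant (All.irrelevant (λ {x} → partOK-irrelevant x))
                               (×-irrelevant (gapOK-irrelevant xs) ≡-irrelevant))
                 (×-irrelevant ≡-irrelevant ≡-irrelevant)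

  DurfeeSet-≡ : {p q : DurfeeSet n k ℓ} → proj₁ p ≡ proj₁ q → p ≡ q
  DurfeeSet-≡ = Σ-≡-irrelevant λ ys →
    ×-irrelevant (×-irrelevant (All.irrelevant ≤-irrelevant)
                               (×-irrelevant (strictDec-irrelevant ys) ≡-irrelevant))
                 (×-irrelevant ≡-irrelevant ≡-irrelevant)

  L3→Durfee : L3Set n k ℓ → DurfeeSet n k ℓ
  L3→Durfee (xs , (ok , gp , sum≡n) , reds≡k , greens≡ℓ)
    with pos , sd ← fromHooks-distinct xs (ok , gp) =
    fromHooks xs , (pos , sd , trans (sum-fromHooks xs (ok , gp)) sum≡n) , length≡ ,
    trans (durfee-fromHooks xs (ok , gp))
          (trans (length≡reds+greens xs) (cong₂ _+_ reds≡k greens≡ℓ))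
    where
    open ≡-Reasoning
    length≡ : length (fromHooks xs) ≡ k + (ℓ + ℓ)
    length≡ = begin
      length (fromHooks xs)             ≡⟨ length-fromHooks xs ⟩
      length xs + greens xs             ≡⟨ cong (_+ greens xs) (length≡reds+greens xs) ⟩
      reds xs + greens xs + greens xs   ≡⟨ +-assoc (reds xs) (greens xs) (greens xs) ⟩
      reds xs + (greens xs + greens xs) ≡⟨ cong₂ (λ r g → r + (g + g)) reds≡k greens≡ℓ ⟩
      k + (ℓ + ℓ)                       ∎

  Durfee→L3 : DurfeeSet n k ℓ → L3Set n k ℓ
  Durfee→L3 (ys , (pos , sd , sum≡n) , length≡ , durfee≡) =
    xs , (proj₁ adm , proj₂ adm , sum≡n′) , reds≡k , greens≡ℓ
    where
    xs = hooks (k + ℓ) ys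
    adm = hooks-admissible (k + ℓ) ys (pos , sd)
    roundTrip = fromHooks-hooks (k + ℓ) ys (pos , sd) durfee≡
    sum≡n′ : sum (map proj₁ xs) ≡ n
    sum≡n′ = trans (sym (sum-fromHooks xs adm)) (trans (cong sum roundTrip) sum≡n)
    #hooks≡k+ℓ : length xs ≡ k + ℓ
    #hooks≡k+ℓ = trans (sym (durfee-fromHooks xs adm)) (trans (cong durfee roundTrip) durfee≡)
    greens≡ℓ : greens xs ≡ ℓ
    greens≡ℓ = +-cancelˡ-≡ (k + ℓ) (greens xs) ℓ (begin
      k + ℓ + greens xs     ≡⟨ cong (_+ greens xs) #hooks≡k+ℓ ⟨
      length xs + greens xs ≡⟨ length-fromHooks xs ⟨
      length (fromHooks xs) ≡⟨ cong length roundTrip ⟩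
      length ys             ≡⟨ length≡ ⟩
      k + (ℓ + ℓ)           ≡⟨ +-assoc k ℓ ℓ ⟨
      k + ℓ + ℓ             ∎)
      where open ≡-Reasoning
    reds≡k : reds xs ≡ k
    reds≡k = +-cancelʳ-≡ ℓ (reds xs) k
      (trans (cong (reds xs +_) (sym greens≡ℓ)) (trans (sym (length≡reds+greens xs)) #hooks≡k+ℓ))

  Durfee→L3→Durfee : (p : DurfeeSet n k ℓ) → L3→Durfee (Durfee→L3 p) ≡ p
  Durfee→L3→Durfee (ys , (pos , sd , _) , _ , durfee≡) =
    DurfeeSet-≡ (fromHooks-hooks (k + ℓ) ys (pos , sd) durfee≡)

  L3→Durfee→L3 : (p : L3Set n k ℓ) → Durfee→L3 (L3→Durfee p) ≡ p
  L3→Durfee→L3 (xs , (ok , gp , _) , reds≡k , greens≡ℓ) =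
    L3Set-≡ (subst (λ d → hooks d (fromHooks xs) ≡ xs)
                   (trans (length≡reds+greens xs) (cong₂ _+_ reds≡k greens≡ℓ))
                   (hooks-fromHooks xs (ok , gp)))

theorem1p6 : (n k ℓ : ℕ) → L3Set n k ℓ ↔ DurfeeSet n k ℓ
theorem1p6 n k ℓ = mk↔ₛ′ L3→Durfee Durfee→L3 Durfee→L3→Durfee L3→Durfee→L3
  where open Bijection n k ℓ
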